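{- Let $Z$ be a set, $\mathcal{Y}\subseteq\mathcal{P}(Z)$, let $\mathcal{A}$ be a finite set of pairwise disjoint nonempty subsets of $Z$ with union $Z$, totally ordered by a relation $<$, and let $\mu:\mathcal{Y}\to\mathcal{P}(Z)$ satisfy $(\mu\subseteq)$, $(\mu PR)$ and $(\mu\mathcal{A})$. Let $U\in\mathcal{Y}$. If $x\in U$ and there is $x'\in U$ with $rg(x')<rg(x)$, then for every $f\in\Pi_x$ we have $\mathrm{ran}(f)\cap U\neq\emptyset$.
   Context: For $x\in Z$, $rg(x)$ is the unique $A\in\mathcal{A}$ with $x\in A$, and $rg(x)<rg(y)$ refers to the order on $\mathcal{A}$. $(\mu\subseteq)$: $\mu(X)\subseteq X$ for all $X\in\mathcal{Y}$. $(\mu PR)$: for $X,Y\in\mathcal{Y}$, $X\subseteq Y$ implies $\mu(Y)\cap X\subseteq\mu(X)$. $(\mu\mathcal{A})$: if $X\in\mathcal{Y}$, $A,A'\in\mathcal{A}$, $A<A'$, $X\cap A\neq\emptyset$ and $X\cap A'\neq\emptyset$, then $\mu(X)\cap A'=\emptyset$. For $x\in Z$, $\mathcal{Y}_x:=\{Y\in\mathcal{Y}:x\in Y-\mu(Y)\}$ and $\Pi_x$ is the set of functions $f$ with domain $\mathcal{Y}_x$ and $f(Y)\in Y$ for all $Y\in\mathcal{Y}_x$. -}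

module Defs where

open import Level using (0ℓ)
open import Data.Nat using (ℕ)
open import Data.Fin using (Fin; _<_)
open import Data.Product using (Σ; ∃; _×_; _,_; proj₁)
open import Relation.Unary using (Pred; _∈_; _∉_; _⊆_; _∩_)
open import Relation.Binary.PropositionalEquality using (_≡_)

Subset : Set → Set₁
Subset Z = Pred Z 0ℓ

-- The partition 𝒜 = {A₀ < A₁ < … < A_{n-1}} of Z is given by its rank
-- function rg : Z → Fin n (rg x = index of the unique block containing x);
-- the order on 𝒜 is the order on Fin n.
Block : {Z : Set} {n : ℕ} → (Z → Fin n) → Fin n → Subset Z
Block rg k z = rg z ≡ k

BlocksNonempty : {Z : Set} {n : ℕ} → (Z → Fin n) → Set
BlocksNonempty {Z} {n} rg = (k : Fin n) → ∃ λ (z : Z) → rg z ≡ k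

MuSub : {Z : Set} → (Subset Z → Set) → (Subset Z → Subset Z) → Set₁
MuSub 𝒴 μ = ∀ X → 𝒴 X → μ X ⊆ X

MuPR : {Z : Set} → (Subset Z → Set) → (Subset Z → Subset Z) → Set₁
MuPR 𝒴 μ = ∀ X Y → 𝒴 X → 𝒴 Y → X ⊆ Y → (μ Y ∩ X) ⊆ μ X

MuA : {Z : Set} {n : ℕ} → (Z → Fin n) → (Subset Z → Set) → (Subset Z → Subset Z) → Set₁
MuA {Z} {n} rg 𝒴 μ =
  ∀ X → 𝒴 X → (k k' : Fin n) → k < k' →
  (∃ λ z → z ∈ X × z ∈ Block rg k) →
  (∃ λ z → z ∈ X × z ∈ Block rg k') →
  ∀ z → z ∈ μ X → z ∉ Block rg k'

Yx : {Z : Set} → (Subset Z → Set) → (Subset Z → Subset Z) → Z → Set₁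
Yx {Z} 𝒴 μ x = Σ (Subset Z) λ Y → 𝒴 Y × x ∈ Y × x ∉ μ Y

Πx : {Z : Set} → (Subset Z → Set) → (Subset Z → Subset Z) → Z → Set₁
Πx {Z} 𝒴 μ x = Σ (Yx 𝒴 μ x → Z) λ f → ∀ (p : Yx 𝒴 μ x) → f p ∈ proj₁ p

module Submission where

-- The hypothesis x' ∈ U with rg x' < rg x says that U
-- meets two blocks of the partition, the block of x being the higher one.
-- By (μ𝒜) the higher block is disjoint from μ(U), so x ∉ μ(U).  Together
-- with x ∈ U and U ∈ 𝒴 this means U ∈ 𝒴_x, and then every f ∈ Π_x
-- satisfies f(U) ∈ U, so ran(f) ∩ U ≠ ∅ with witness f(U).

open import Defs
open import Data.Nat using (ℕ)
open import Data.Fin using (Fin; _<_)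
open import Data.Product using (∃; _×_; proj₁; proj₂; _,_)
open import Relation.Binary.PropositionalEquality using (refl)
open import Relation.Unary using (_∈_; _∉_)

notMinimal-of-lowerRank : {Z : Set} {n : ℕ} (rg : Z → Fin n)
  (𝒴 : Subset Z → Set) (μ : Subset Z → Subset Z) → MuA rg 𝒴 μ →
  (X : Subset Z) → 𝒴 X → (x : Z) → x ∈ X →
  (∃ λ x' → x' ∈ X × rg x' < rg x) → x ∉ μ X
notMinimal-of-lowerRank rg 𝒴 μ muA X X∈𝒴 x x∈X (x' , x'∈X , x'<x) x∈μX =
  muA X X∈𝒴 (rg x') (rg x) x'<x (x' , x'∈X , refl) (x , x∈X , refl) x x∈μX refl

inYx-of-lowerRank : {Z : Set} {n : ℕ} (rg : Z → Fin n)
  (𝒴 : Subset Z → Set) (μ : Subset Z → Subset Z) → MuA rg 𝒴 μ →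
  (X : Subset Z) → 𝒴 X → (x : Z) → x ∈ X →
  (∃ λ x' → x' ∈ X × rg x' < rg x) → Yx 𝒴 μ x
inYx-of-lowerRank rg 𝒴 μ muA X X∈𝒴 x x∈X lower =
  X , X∈𝒴 , x∈X , notMinimal-of-lowerRank rg 𝒴 μ muA X X∈𝒴 x x∈X lower

corollary3p4 : {Z : Set} {n : ℕ} (rg : Z → Fin n) → BlocksNonempty rg →
    (𝒴 : Subset Z → Set) (μ : Subset Z → Subset Z) →
    MuSub 𝒴 μ → MuPR 𝒴 μ → MuA rg 𝒴 μ →
    (U : Subset Z) → 𝒴 U →
    (x : Z) → x ∈ U → (∃ λ x' → x' ∈ U × rg x' < rg x) →
    (f : Πx 𝒴 μ x) → ∃ λ (p : Yx 𝒴 μ x) → proj₁ f p ∈ U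
corollary3p4 rg _ 𝒴 μ _ _ muA U U∈𝒴 x x∈U lower (f , f∈dom) =
  U∈𝒴x , f∈dom U∈𝒴x
  where
  U∈𝒴x : Yx 𝒴 μ x
  U∈𝒴x = inYx-of-lowerRank rg 𝒴 μ muA U U∈𝒴 x x∈U lower
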